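{- Consider an instance of the destructive weighted-\$-protection problem and let $\mathcal V_F\subseteq\mathcal V$ be a set of awarded voters. Suppose the attacker can succeed (make some candidate other than $c_m$ obtain a score strictly higher than $c_m$) by bribing a set $\mathcal V_B\subseteq\mathcal V\setminus\mathcal V_F$ with $\sum_{v_j\in\mathcal V_B}p^b_j\le B$. If $v_{j'}\prec v_j$, $v_{j'}\in\mathcal V_B$ and $v_j\notin\mathcal V_F\cup\mathcal V_B$, then the attacker can also succeed by bribing $(\mathcal V_B\setminus\{v_{j'}\})\cup\{v_j\}$.
   Context: An election has candidates $c_1,\dots,c_m$ and voters $\mathcal V=\{v_1,\dots,v_n\}$; voter $v_j$ has a preference list $\tau_j$, weight $w_j\in\mathbb Z_{>0}$, awarding price $p^a_j$ and bribing price $p^b_j$. Under a scoring rule $\alpha_1\ge\dots\ge\alpha_m$ (nonnegative integers), $v_j$ gives $w_j\alpha_z$ points to the candidate in position $z$ of its list; $c_m$ is the winner without bribery. The defender awards $\mathcal V_F$ (total awarding price $\le F$); the attacker with budget $B$ bribes $\mathcal V_B\subseteq\mathcal V\setminus\mathcal V_F$ with total bribing price $\le B$ and can replace the lists of bribed voters arbitrarily; the attacker succeeds if some $c\ne c_m$ ends with a score strictly higher than $c_m$. Dominance: $v_{j'}\prec v_j$ ($v_j$ dominates $v_{j'}$) if either (i) $\tau_j=\tau_{j'}$, $w_j\ge w_{j'}$, $p^a_j\le p^a_{j'}$, $p^b_j\le p^b_{j'}$ and at least one of these three inequalities is strict; or (ii) $\tau_j=\tau_{j'}$, $w_j=w_{j'}$,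 $p^a_j=p^a_{j'}$, $p^b_j=p^b_{j'}$ and $j'<j$. -}

module Defs where

open import Data.Nat using (ℕ; zero; suc; _+_; _*_; _≤_; _<_; _≥_)
open import Data.Fin using (Fin; fromℕ)
import Data.Fin as F
open import Data.Fin.Subset using (Subset; _∈_; _∉_)
open import Data.Fin.Permutation using (Permutation′; _⟨$⟩ʳ_; _⟨$⟩ˡ_)
open import Data.Vec using (lookup)
open import Data.Bool using (if_then_else_)
open import Data.Product using (Σ; _×_; ∃)
open import Data.Sum using (_⊎_)
open import Relation.Binary.PropositionalEquality using (_≡_; _≢_)

∑ : (n : ℕ) → (Fin n → ℕ) → ℕ
∑ zero    f = 0
∑ (suc n) f = f F.zero + ∑ n (λ i → f (F.suc i))

-- A preference list over candidates Fin m: position z ↦ candidate τ ⟨$⟩ʳ z,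
-- and hence candidate c sits at position τ ⟨$⟩ˡ c.
PrefList : ℕ → Set
PrefList m = Permutation′ m

cost : {n : ℕ} → (Fin n → ℕ) → Subset n → ℕ
cost {n} p S = ∑ n (λ i → if lookup S i then p i else 0)

record Election (m n : ℕ) : Set where
  field
    α    : Fin m → ℕ
    τ    : Fin n → PrefList m
    w    : Fin n → ℕ
    pa   : Fin n → ℕ
    pb   : Fin n → ℕ

score : {m n : ℕ} → Election m n → (Fin n → PrefList m) → Fin m → ℕ
score {m} {n} E σ c = ∑ n (λ j → Election.w E j * Election.α E (σ j ⟨$⟩ˡ c))

afterBribe : {m n : ℕ} → Election m n → Subset n → (Fin n → PrefList m) → Fin n → PrefList m
afterBribe E VB π j = if lookup VB j then π j else Election.τ E j

SameList : {m : ℕ} → PrefList m → PrefList m → Set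
SameList {m} τ τ' = (z : Fin m) → τ ⟨$⟩ʳ z ≡ τ' ⟨$⟩ʳ z

-- The distinguished candidate c_m (last candidate) with m = suc k.
cLast : (k : ℕ) → Fin (suc k)
cLast k = fromℕ k

Succeeds : {k n : ℕ} → Election (suc k) n → Subset n → (Fin n → PrefList (suc k)) → Set
Succeeds {k} E VB π =
  Σ (Fin (suc k)) λ c → c ≢ cLast k ×
    score E (afterBribe E VB π) (cLast k) < score E (afterBribe E VB π) c

CanSucceedWith : {k n : ℕ} → Election (suc k) n → (VF VB : Subset n) → (B : ℕ) → Set
CanSucceedWith {k} {n} E VF VB B =
  ((i : Fin n) → i ∈ VB → i ∉ VF) ×
  cost (Election.pb E) VB ≤ B ×
  ∃ λ π → Succeeds E VB π

-- Dominance: Dominated E j' j  means  v_{j'} ≺ v_j  (v_j dominates v_{j'}).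
Dominated : {m n : ℕ} → Election m n → Fin n → Fin n → Set
Dominated E j' j =
  (SameList (τ j) (τ j') × w j ≥ w j' × pa j ≤ pa j' × pb j ≤ pb j' ×
     (w j > w j' ⊎ pa j < pa j' ⊎ pb j < pb j'))
  ⊎
  (SameList (τ j) (τ j') × w j ≡ w j' × pa j ≡ pa j' × pb j ≡ pb j' × j' F.< j)
  where
    open Election E
    _>_ : ℕ → ℕ → Set
    a > b = b < a

-- Moving the bribe from v_j' to v_j changes only these two ballots, and since
-- τ_j = τ_j' the unbribed v_j' now casts exactly the ballot v_j cast before.
-- Let δ be the gain in the lead of c over c_m when one unit of weight switches
-- from τ_j to the attacker's list π_j'. Giving v_j the list π_j' changes the
-- lead by (w_j − w_j')·δ, leaving v_j with τ_j changes it by −w_j'·δ; as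
-- w_j ≥ w_j', one of the two is nonnegative, so c keeps its strict lead.
-- Since p^b_j ≤ p^b_j', the new bribery stays within the budget. Neither
-- monotonicity of α nor the defender's choice plays any role.
module Submission where

open import Defs
open import Data.Nat using (ℕ; zero; suc; _+_; _*_; _≤_; _<_; _≥_; _>_)
open import Data.Nat.Properties
  using (+-assoc; +-comm; +-identityʳ; +-monoʳ-≤; +-mono-<-≤; +-cancelʳ-≤; +-cancelʳ-<;
         *-monoʳ-≤; ≤-total; ≤-trans; ≤-reflexive; m≤n⇒∃[o]m+o≡n; module ≤-Reasoning)
open import Data.Nat.Tactic.RingSolver using (solve-∀)
open import Data.Fin using (Fin) renaming (_≤_ to _≤ᶠ_)
import Data.Fin as Fin
open import Data.Fin.Properties using (suc-injective; _≟_)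
open import Data.Fin.Subset using (Subset; _∈_; _∉_; _∪_; _-_; ⁅_⁆; inside; outside)
open import Data.Fin.Subset.Properties
  using (_∈?_; x∈p∪q⁺; x∈p∪q⁻; x∈⁅x⁆; x∈⁅y⁆⇒x≡y; x≢y⇒x∉⁅y⁆; x∈p∧x∉q⇒x∈p─q; p─q⊆p)
open import Data.Fin.Permutation using (_⟨$⟩ʳ_; _⟨$⟩ˡ_; inverseˡ; inverseʳ)
open import Data.Vec using (_∷_; lookup; there)
open import Data.Vec.Properties using ([]=⇒lookup; lookup⇒[]=)
open import Data.Vec.Functional using (updateAt)
open import Data.Vec.Functional.Properties using (updateAt-updates; updateAt-minimal)
open import Data.Bool using (if_then_else_)
open import Data.Product using (_,_; ∃)
open import Data.Sum using (_⊎_; inj₁; inj₂)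
open import Function using (_∘_; const)
open import Relation.Nullary using (yes; no; contradiction)
open import Relation.Binary.PropositionalEquality
  using (_≡_; _≢_; refl; sym; trans; cong; cong₂; subst₂; module ≡-Reasoning)

∑-cong : ∀ n {f g : Fin n → ℕ} → (∀ i → f i ≡ g i) → ∑ n f ≡ ∑ n g
∑-cong zero    f≗g = refl
∑-cong (suc n) f≗g = cong₂ _+_ (f≗g Fin.zero) (∑-cong n (f≗g ∘ Fin.suc))

∑-update : ∀ n (f g : Fin n → ℕ) (j : Fin n) → (∀ i → i ≢ j → f i ≡ g i) →
           ∑ n f + g j ≡ ∑ n g + f j
∑-update (suc n) f g Fin.zero f≗g = begin
  f Fin.zero + ∑ n (f ∘ Fin.suc) + g Fin.zero
    ≡⟨ cong (λ s → f Fin.zero + s + g Fin.zero) (∑-cong n (λ i → f≗g (Fin.suc i) λ ())) ⟩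
  f Fin.zero + ∑ n (g ∘ Fin.suc) + g Fin.zero
    ≡⟨ swap-outer (f Fin.zero) _ (g Fin.zero) ⟩
  g Fin.zero + ∑ n (g ∘ Fin.suc) + f Fin.zero ∎
  where
  open ≡-Reasoning
  swap-outer : ∀ x s y → x + s + y ≡ y + s + x
  swap-outer = solve-∀
∑-update (suc n) f g (Fin.suc j) f≗g = begin
  f Fin.zero + ∑ n (f ∘ Fin.suc) + g (Fin.suc j)
    ≡⟨ +-assoc (f Fin.zero) _ _ ⟩
  f Fin.zero + (∑ n (f ∘ Fin.suc) + g (Fin.suc j))
    ≡⟨ cong₂ _+_ (f≗g Fin.zero λ ())
         (∑-update n (f ∘ Fin.suc) (g ∘ Fin.suc) j (λ i i≢j → f≗g (Fin.suc i) (i≢j ∘ suc-injective))) ⟩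
  g Fin.zero + (∑ n (g ∘ Fin.suc) + f (Fin.suc j))
    ≡⟨ +-assoc (g Fin.zero) _ _ ⟨
  g Fin.zero + ∑ n (g ∘ Fin.suc) + f (Fin.suc j) ∎
  where open ≡-Reasoning

∑-update₂ : ∀ n (f g : Fin n → ℕ) (j j' : Fin n) → j ≢ j' →
            (∀ i → i ≢ j → i ≢ j' → f i ≡ g i) →
            ∑ n f + g j + g j' ≡ ∑ n g + f j + f j'
∑-update₂ n f g j j' j≢j' f≗g = begin
  ∑ n f + g j + g j'  ≡⟨ cong (λ x → ∑ n f + x + g j') (updateAt-updates j f) ⟨
  ∑ n f + h j + g j'  ≡⟨ cong (_+ g j') (∑-update n f h j f≗h) ⟩
  ∑ n h + f j + g j'  ≡⟨ swap-last (∑ n h) (f j) (g j') ⟩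
  ∑ n h + g j' + f j  ≡⟨ cong (_+ f j) (∑-update n h g j' h≗g) ⟩
  ∑ n g + h j' + f j  ≡⟨ cong (λ x → ∑ n g + x + f j) (updateAt-minimal j' j f (j≢j' ∘ sym)) ⟩
  ∑ n g + f j' + f j  ≡⟨ swap-last (∑ n g) (f j') (f j) ⟩
  ∑ n g + f j + f j'  ∎
  where
  open ≡-Reasoning
  h : Fin n → ℕ
  h = updateAt f j (const (g j))
  f≗h : ∀ i → i ≢ j → f i ≡ h i
  f≗h i i≢j = sym (updateAt-minimal i j f i≢j)
  h≗g : ∀ i → i ≢ j' → h i ≡ g i
  h≗g i i≢j' with i ≟ j
  ... | yes refl = updateAt-updates j f
  ... | no i≢j   = trans (updateAt-minimal i j f i≢j) (f≗g i i≢j i≢j')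
  swap-last : ∀ x y z → x + y + z ≡ x + z + y
  swap-last = solve-∀

∉⇒lookup≡outside : ∀ {n} {p : Subset n} {i : Fin n} → i ∉ p → lookup p i ≡ outside
∉⇒lookup≡outside {p = p} {i} i∉p with lookup p i in eq
... | inside  = contradiction (lookup⇒[]= i p eq) i∉p
... | outside = refl

lookup-cong-∈ : ∀ {n} {p q : Subset n} {i : Fin n} →
                (i ∈ p → i ∈ q) → (i ∈ q → i ∈ p) → lookup p i ≡ lookup q i
lookup-cong-∈ {p = p} {q} {i} p⇒q q⇒p with i ∈? p
... | yes i∈p = trans ([]=⇒lookup i∈p) (sym ([]=⇒lookup (p⇒q i∈p)))
... | no  i∉p = trans (∉⇒lookup≡outside i∉p) (sym (∉⇒lookup≡outside (i∉p ∘ q⇒p)))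

x∉p-x : ∀ {n} (p : Subset n) (x : Fin n) → x ∉ p - x
x∉p-x (s ∷ p) Fin.zero    ()
x∉p-x (s ∷ p) (Fin.suc x) (there x∈p-x) = x∉p-x p x x∈p-x

∈-swap : ∀ {n} (p : Subset n) (j j' : Fin n) → j ∈ (p - j') ∪ ⁅ j ⁆
∈-swap p j j' = x∈p∪q⁺ (inj₂ (x∈⁅x⁆ j))

∉-swap : ∀ {n} (p : Subset n) {j j' : Fin n} → j' ≢ j → j' ∉ (p - j') ∪ ⁅ j ⁆
∉-swap p {j} {j'} j'≢j j'∈ with x∈p∪q⁻ (p - j') ⁅ j ⁆ j'∈
... | inj₁ j'∈p-j' = x∉p-x p j' j'∈p-j'
... | inj₂ j'∈⁅j⁆  = j'≢j (x∈⁅y⁆⇒x≡y j j'∈⁅j⁆)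

∈-swap⁻ : ∀ {n} (p : Subset n) {i j j' : Fin n} → i ≢ j → i ∈ (p - j') ∪ ⁅ j ⁆ → i ∈ p
∈-swap⁻ p {i} {j} {j'} i≢j i∈ with x∈p∪q⁻ (p - j') ⁅ j ⁆ i∈
... | inj₁ i∈p-j' = p─q⊆p p ⁅ j' ⁆ i∈p-j'
... | inj₂ i∈⁅j⁆  = contradiction (x∈⁅y⁆⇒x≡y j i∈⁅j⁆) i≢j

lookup-swap : ∀ {n} (p : Subset n) {i j j' : Fin n} → i ≢ j → i ≢ j' →
              lookup ((p - j') ∪ ⁅ j ⁆) i ≡ lookup p i
lookup-swap p i≢j i≢j' = lookup-cong-∈ (∈-swap⁻ p i≢j)
  (λ i∈p → x∈p∪q⁺ (inj₁ (x∈p∧x∉q⇒x∈p─q i∈p (x≢y⇒x∉⁅y⁆ i≢j'))))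

cost-swap : ∀ {n} (c : Fin n → ℕ) (p : Subset n) {j j' : Fin n} → j ∉ p → j' ∈ p →
            cost c ((p - j') ∪ ⁅ j ⁆) + c j' ≡ cost c p + c j
cost-swap {n} c p {j} {j'} j∉p j'∈p = begin
  cost c q + c j'          ≡⟨ cong (_+ c j') (+-identityʳ (cost c q)) ⟨
  cost c q + 0 + c j'      ≡⟨ cong₂ (λ x y → cost c q + x + y) (chosen-outside p j∉p) (chosen-inside p j'∈p) ⟨
  cost c q + chosen p j + chosen p j'
    ≡⟨ ∑-update₂ n (chosen q) (chosen p) j j' j≢j' (λ i i≢j i≢j' → cong (if_then c i else 0) (lookup-swap p i≢j i≢j')) ⟩
  cost c p + chosen q j + chosen q j'
    ≡⟨ cong₂ (λ x y → cost c p + x + y) (chosen-inside q (∈-swap p j j')) (chosen-outside q (∉-swap p (j≢j' ∘ sym))) ⟩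
  cost c p + c j + 0       ≡⟨ +-identityʳ (cost c p + c j) ⟩
  cost c p + c j           ∎
  where
  open ≡-Reasoning
  q : Subset n
  q = (p - j') ∪ ⁅ j ⁆
  j≢j' : j ≢ j'
  j≢j' refl = j∉p j'∈p
  chosen : Subset n → Fin n → ℕ
  chosen s i = if lookup s i then c i else 0
  chosen-inside : ∀ s {i} → i ∈ s → chosen s i ≡ c i
  chosen-inside s i∈s = cong (if_then c _ else 0) ([]=⇒lookup i∈s)
  chosen-outside : ∀ s {i} → i ∉ s → chosen s i ≡ 0
  chosen-outside s i∉s = cong (if_then c _ else 0) (∉⇒lookup≡outside i∉s)

SameList⇒⟨$⟩ˡ : ∀ {m} (τ τ' : PrefList m) → SameList τ τ' → ∀ c → τ ⟨$⟩ˡ c ≡ τ' ⟨$⟩ˡ c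
SameList⇒⟨$⟩ˡ τ τ' τ≈τ' c = begin
  τ ⟨$⟩ˡ c                        ≡⟨ inverseˡ τ' ⟨
  τ' ⟨$⟩ˡ (τ' ⟨$⟩ʳ (τ ⟨$⟩ˡ c))    ≡⟨ cong (τ' ⟨$⟩ˡ_) (τ≈τ' (τ ⟨$⟩ˡ c)) ⟨
  τ' ⟨$⟩ˡ (τ ⟨$⟩ʳ (τ ⟨$⟩ˡ c))     ≡⟨ cong (τ' ⟨$⟩ˡ_) (inverseʳ τ) ⟩
  τ' ⟨$⟩ˡ c                        ∎
  where open ≡-Reasoning

module _ {m n} (E : Election m n) {j' j : Fin n} where
  open Election E

  Dominated⇒SameList : Dominated E j' j → SameList (τ j) (τ j')
  Dominated⇒SameList (inj₁ (τ≈ , _)) = τ≈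
  Dominated⇒SameList (inj₂ (τ≈ , _)) = τ≈

  Dominated⇒w≤ : Dominated E j' j → w j' ≤ w j
  Dominated⇒w≤ (inj₁ (_ , w≥ , _))    = w≥
  Dominated⇒w≤ (inj₂ (_ , w≡ , _))    = ≤-reflexive (sym w≡)

  Dominated⇒pb≤ : Dominated E j' j → pb j ≤ pb j'
  Dominated⇒pb≤ (inj₁ (_ , _ , _ , pb≤ , _)) = pb≤
  Dominated⇒pb≤ (inj₂ (_ , _ , _ , pb≡ , _)) = ≤-reflexive pb≡

lead-preserved : ∀ {oc ol nc nl uc ul vc vl : ℕ} →
                 oc + uc ≡ nc + vc → ol + ul ≡ nl + vl → ul + vc ≤ uc + vl →
                 ol < oc → nl < nc
lead-preserved {oc} {ol} {nc} {nl} {uc} {ul} {vc} {vl} eqc eql u≤v ol<oc =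
  +-cancelʳ-< (vl + vc) nl nc (begin-strict
    nl + (vl + vc)   ≡⟨ +-assoc nl vl vc ⟨
    nl + vl + vc     ≡⟨ cong (_+ vc) eql ⟨
    ol + ul + vc     ≡⟨ +-assoc ol ul vc ⟩
    ol + (ul + vc)   <⟨ +-mono-<-≤ ol<oc u≤v ⟩
    oc + (uc + vl)   ≡⟨ +-assoc oc uc vl ⟨
    oc + uc + vl     ≡⟨ cong (_+ vl) eqc ⟩
    nc + vc + vl     ≡⟨ +-assoc nc vc vl ⟩
    nc + (vc + vl)   ≡⟨ cong (nc +_) (+-comm vc vl) ⟩
    nc + (vl + vc)   ∎)
  where open ≤-Reasoning

rearrangement : ∀ {W w x y : ℕ} → w ≤ W → x ≤ y → W * x + w * y ≤ W * y + w * x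
rearrangement {W} {w} {x} {y} w≤W x≤y with m≤n⇒∃[o]m+o≡n w≤W
... | d , refl = subst₂ _≤_ (splitˡ w d x y) (splitʳ w d x y)
                   (+-monoʳ-≤ (w * (x + y)) (*-monoʳ-≤ d x≤y))
  where
  splitˡ : ∀ w d x y → w * (x + y) + d * x ≡ (w + d) * x + w * y
  splitˡ = solve-∀
  splitʳ : ∀ w d x y → w * (x + y) + d * y ≡ (w + d) * y + w * x
  splitʳ = solve-∀

-- With a, b (p, q) the points of τ_j (π_j') at c and c_m, the disjuncts say that
-- giving v_j the list π_j', resp. leaving it τ_j, does not shrink the lead of c.
one-swap-favours : ∀ {W w : ℕ} (a b p q : ℕ) → w ≤ W →
    W * q + w * b + (W * a + w * p) ≤ W * p + w * a + (W * b + w * q)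
  ⊎ W * b + w * b + (W * a + w * p) ≤ W * a + w * a + (W * b + w * q)
one-swap-favours {W} {w} a b p q w≤W with ≤-total (q + a) (p + b)
... | inj₁ δ≥0 = inj₁ (subst₂ _≤_ (regroup W w a b p q) (regroup W w b a q p) (rearrangement w≤W δ≥0))
  where
  regroup : ∀ W w a b p q → W * (q + a) + w * (p + b) ≡ W * q + w * b + (W * a + w * p)
  regroup = solve-∀
... | inj₂ δ≤0 = inj₂ (subst₂ _≤_ (regroupˡ W w a b p) (regroupʳ W w a b q)
                          (+-monoʳ-≤ (W * a + W * b) (*-monoʳ-≤ w δ≤0)))
  where
  regroupˡ : ∀ W w a b p → W * a + W * b + w * (p + b) ≡ W * b + w * b + (W * a + w * p)
  regroupˡ = solve-∀
  regroupʳ : ∀ W w a b q → W * a + W * b + w * (q + a) ≡ W * a + w * a + (W * b + w * q)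
  regroupʳ = solve-∀

points : ∀ {m n} → Election m n → (Fin n → PrefList m) → Fin m → Fin n → ℕ
points E σ c i = Election.w E i * Election.α E (σ i ⟨$⟩ˡ c)

score-update₂ : ∀ {m n} (E : Election m n) (σ σ' : Fin n → PrefList m) {j j' : Fin n} →
                j ≢ j' → (∀ i → i ≢ j → i ≢ j' → σ i ≡ σ' i) → ∀ c →
                score E σ c + points E σ' c j + points E σ' c j'
                  ≡ score E σ' c + points E σ c j + points E σ c j'
score-update₂ {n = n} E σ σ' {j} {j'} j≢j' σ≗σ' c =
  ∑-update₂ n (points E σ c) (points E σ' c) j j' j≢j'
    (λ i i≢j i≢j' → cong (λ ρ → Election.w E i * Election.α E (ρ ⟨$⟩ˡ c)) (σ≗σ' i i≢j i≢j'))

module BriberySwap {k n} (E : Election (suc k) n) (VB : Subset n) (π : Fin n → PrefList (suc k))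
                   {j j' : Fin n} (j∉VB : j ∉ VB) (j'∈VB : j' ∈ VB)
                   (τj≈τj' : SameList (Election.τ E j) (Election.τ E j')) where
  open Election E

  j≢j' : j ≢ j'
  j≢j' refl = j∉VB j'∈VB

  VB' : Subset n
  VB' = (VB - j') ∪ ⁅ j ⁆

  before : Fin n → PrefList (suc k)
  before = afterBribe E VB π

  after : PrefList (suc k) → Fin n → PrefList (suc k)
  after ρ = afterBribe E VB' (updateAt π j (const ρ))

  own : Fin (suc k) → ℕ
  own x = α (τ j ⟨$⟩ˡ x)

  bribed : Fin (suc k) → ℕ
  bribed x = α (π j' ⟨$⟩ˡ x)

  before-j : before j ≡ τ j
  before-j = cong (if_then π j else τ j) (∉⇒lookup≡outside j∉VB)

  before-j' : before j' ≡ π j'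
  before-j' = cong (if_then π j' else τ j') ([]=⇒lookup j'∈VB)

  after-j : ∀ ρ → after ρ j ≡ ρ
  after-j ρ = trans (cong (if_then updateAt π j (const ρ) j else τ j) ([]=⇒lookup (∈-swap VB j j')))
                    (updateAt-updates j π)

  after-j' : ∀ ρ → after ρ j' ≡ τ j'
  after-j' ρ = cong (if_then updateAt π j (const ρ) j' else τ j') (∉⇒lookup≡outside (∉-swap VB (j≢j' ∘ sym)))

  before≗after : ∀ ρ i → i ≢ j → i ≢ j' → before i ≡ after ρ i
  before≗after ρ i i≢j i≢j' = cong₂ (if_then_else τ i)
    (sym (lookup-swap VB i≢j i≢j')) (sym (updateAt-minimal i j π i≢j))

  score-swap : ∀ ρ x → score E before x + (w j * α (ρ ⟨$⟩ˡ x) + w j' * own x)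
                     ≡ score E (after ρ) x + (w j * own x + w j' * bribed x)
  score-swap ρ x = begin
    score E before x + (w j * α (ρ ⟨$⟩ˡ x) + w j' * own x)
      ≡⟨ +-assoc (score E before x) _ _ ⟨
    score E before x + w j * α (ρ ⟨$⟩ˡ x) + w j' * own x
      ≡⟨ cong₂ (λ y z → score E before x + w j * y + w j' * z) (at x (sym (after-j ρ)))
           (trans (cong α (SameList⇒⟨$⟩ˡ (τ j) (τ j') τj≈τj' x)) (at x (sym (after-j' ρ)))) ⟩
    score E before x + points E (after ρ) x j + points E (after ρ) x j'
      ≡⟨ score-update₂ E before (after ρ) j≢j' (before≗after ρ) x ⟩
    score E (after ρ) x + points E before x j + points E before x j'
      ≡⟨ cong₂ (λ y z → score E (after ρ) x + w j * y + w j' * z) (at x before-j) (at x before-j') ⟩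
    score E (after ρ) x + w j * own x + w j' * bribed x
      ≡⟨ +-assoc (score E (after ρ) x) _ _ ⟩
    score E (after ρ) x + (w j * own x + w j' * bribed x) ∎
    where
    open ≡-Reasoning
    at : ∀ x {σ σ' : PrefList (suc k)} → σ ≡ σ' → α (σ ⟨$⟩ˡ x) ≡ α (σ' ⟨$⟩ˡ x)
    at x = cong (λ σ → α (σ ⟨$⟩ˡ x))

  lead-transfer : ∀ ρ {c c' : Fin (suc k)} →
    w j * α (ρ ⟨$⟩ˡ c') + w j' * own c' + (w j * own c + w j' * bribed c)
      ≤ w j * α (ρ ⟨$⟩ˡ c) + w j' * own c + (w j * own c' + w j' * bribed c') →
    score E before c' < score E before c → score E (after ρ) c' < score E (after ρ) c
  lead-transfer ρ {c} {c'} = lead-preserved (score-swap ρ c) (score-swap ρ c')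

lemma5 : {k n : ℕ} (E : Election (suc k) n) (F B : ℕ) (VF VB : Subset n) (j j' : Fin n)
         → ((z z' : Fin (suc k)) → z ≤ᶠ z' → Election.α E z ≥ Election.α E z')
         → ((i : Fin n) → Election.w E i > 0)
         → ((c : Fin (suc k)) → c ≢ cLast k
              → score E (Election.τ E) c ≤ score E (Election.τ E) (cLast k))
         → cost (Election.pa E) VF ≤ F
         → CanSucceedWith E VF VB B
         → Dominated E j' j
         → j' ∈ VB
         → j ∉ VF
         → j ∉ VB
         → CanSucceedWith E VF ((VB - j') ∪ ⁅ j ⁆) B
lemma5 {k} E F B VF VB j j' _ _ _ _ (VB∩VF≡∅ , withinBudget , π , c , c≢cₘ , lead) j'≺j j'∈VB j∉VF j∉VB =
  VB'∩VF≡∅ , ≤-trans cost-VB'≤cost-VB withinBudget , succeeds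
  where
  open Election E
  open BriberySwap E VB π j∉VB j'∈VB (Dominated⇒SameList E j'≺j)

  VB'∩VF≡∅ : ∀ i → i ∈ VB' → i ∉ VF
  VB'∩VF≡∅ i i∈VB' with i ≟ j
  ... | yes refl = j∉VF
  ... | no  i≢j  = VB∩VF≡∅ i (∈-swap⁻ VB i≢j i∈VB')

  cost-VB'≤cost-VB : cost pb VB' ≤ cost pb VB
  cost-VB'≤cost-VB = +-cancelʳ-≤ (pb j') _ _ (begin
    cost pb VB' + pb j'  ≡⟨ cost-swap pb VB j∉VB j'∈VB ⟩
    cost pb VB + pb j    ≤⟨ +-monoʳ-≤ (cost pb VB) (Dominated⇒pb≤ E j'≺j) ⟩
    cost pb VB + pb j'   ∎)
    where open ≤-Reasoning

  succeeds : ∃ (Succeeds E VB')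
  succeeds with one-swap-favours (own c) (own (cLast k)) (bribed c) (bribed (cLast k)) (Dominated⇒w≤ E j'≺j)
  ... | inj₁ favourable = updateAt π j (const (π j')) , c , c≢cₘ , lead-transfer (π j') favourable lead
  ... | inj₂ favourable = updateAt π j (const (τ j))  , c , c≢cₘ , lead-transfer (τ j) favourable lead
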